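{- The set of isotropic lines in $\mathbf V$ (identified with $\mathbf P(\mathbb Q)\backslash\mathbf G(\mathbb Q)$ via $g\mapsto Eb_1g$), with the right action of $\mathbf P(\mathbb Q)$, consists of exactly three $\mathbf P(\mathbb Q)$-orbits, represented by $Eb_1$, $Ec_1$ and $Eb_2$.
   Context: $E$ is an imaginary quadratic field; $(\mathbf V,\langle\,,\rangle)$ is a nondegenerate Hermitian space over $E$ of signature $(2,n)$; $b_1,b_2\in\mathbf V$ are isotropic with $\langle b_1,b_2\rangle=1$; $\mathbf V_0=(Eb_1+Eb_2)^\perp$; $c_1\in\mathbf V_0$ is a nonzero isotropic vector (with isotropic $c_2\in\mathbf V_0$, $\langle c_1,c_2\rangle=1$). $\mathbf G=\mathrm U(\mathbf V)$ acts on $\mathbf V$ on the right and $\mathbf P\subset\mathbf G$ is the stabilizer of the line $Eb_1$. -}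

module Defs where

open import Data.Nat as ℕ using (ℕ; zero; suc)
open import Data.Nat.Divisibility using (_∣_)
open import Data.Integer using (+_)
open import Data.Rational as Q using (ℚ; 0ℚ; 1ℚ)
open import Data.Fin using (Fin; toℕ)
open import Data.Product using (Σ; _×_; ∃)
open import Relation.Binary.PropositionalEquality using (_≡_; _≢_)
open import Relation.Nullary using (¬_)

-- The imaginary quadratic field E = ℚ(√-d), d a squarefree positive
-- integer.  An element  a + b·√-d  is stored as the pair (a , b).

SquarefreePos : ℕ → Set
SquarefreePos d = ∀ m → (m ℕ.* m) ∣ d → m ≡ 1   -- also rules out d = 0

record 𝔼 : Set where
  constructor _+√-d·_
  field
    re : ℚ
    im : ℚ
open 𝔼 public

dℚ : ℕ → ℚ
dℚ d = (+ d) Q./ 1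

0E 1E : 𝔼
0E = 0ℚ +√-d· 0ℚ
1E = 1ℚ +√-d· 0ℚ

addE : 𝔼 → 𝔼 → 𝔼
addE (a +√-d· b) (c +√-d· e) = (a Q.+ c) +√-d· (b Q.+ e)

mulE : ℕ → 𝔼 → 𝔼 → 𝔼
mulE d (a +√-d· b) (c +√-d· e) =
  ((a Q.* c) Q.- (dℚ d Q.* (b Q.* e))) +√-d· ((a Q.* e) Q.+ (b Q.* c))

conj : 𝔼 → 𝔼
conj (a +√-d· b) = a +√-d· (Q.- b)

sumE : ∀ {N} → (Fin N → 𝔼) → 𝔼
sumE {zero}  f = 0E
sumE {suc N} f = addE (f Fin.zero) (sumE (λ i → f (Fin.suc i)))

Vec : ℕ → Set
Vec N = Fin N → 𝔼

Mat : ℕ → Set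
Mat N = Fin N → Fin N → 𝔼

_≈V_ : ∀ {N} → Vec N → Vec N → Set
v ≈V w = ∀ i → v i ≡ w i

IsZeroV : ∀ {N} → Vec N → Set
IsZeroV v = ∀ i → v i ≡ 0E

scale : ∀ {N} → ℕ → 𝔼 → Vec N → Vec N
scale d c v i = mulE d c (v i)

form : ∀ {N} → ℕ → Mat N → Vec N → Vec N → 𝔼
form d H x y = sumE (λ i → sumE (λ j → mulE d (mulE d (x i) (H i j)) (conj (y j))))

IsHermitian : ∀ {N} → Mat N → Set
IsHermitian H = ∀ i j → H j i ≡ conj (H i j)

Nondegenerate : ∀ {N} → ℕ → Mat N → Set
Nondegenerate d H = ∀ x → (∀ y → form d H x y ≡ 0E) → IsZeroV x

-- signature (p , q) on E^(p+q): there are p+q pairwise orthogonal vectors,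
-- the first p of positive norm and the remaining q of negative norm
-- (such a family is an orthogonal basis).
HasSignature : ℕ → (p q : ℕ) → Mat (p ℕ.+ q) → Set
HasSignature d p q H =
  Σ (Fin (p ℕ.+ q) → Vec (p ℕ.+ q)) λ f →
    (∀ i j → i ≢ j → form d H (f i) (f j) ≡ 0E) ×
    (∀ i → toℕ i ℕ.< p → 0ℚ Q.< re (form d H (f i) (f i))) ×
    (∀ i → p ℕ.≤ toℕ i → re (form d H (f i) (f i)) Q.< 0ℚ)

Isotropic : ∀ {N} → ℕ → Mat N → Vec N → Set
Isotropic d H v = form d H v v ≡ 0E

act : ∀ {N} → ℕ → Vec N → Mat N → Vec N
act d v g j = sumE (λ i → mulE d (v i) (g i j))

InU : ∀ {N} → ℕ → Mat N → Mat N → Set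
InU d H g =
  (∀ x y → form d H (act d x g) (act d y g) ≡ form d H x y) ×
  Σ (Mat _) (λ h → ∀ x → (act d (act d x g) h ≈V x) × (act d (act d x h) g ≈V x))

InP : ∀ {N} → ℕ → Mat N → Vec N → Mat N → Set
InP d H b₁ g = InU d H g × Σ 𝔼 (λ c → act d b₁ g ≈V scale d c b₁)

SameOrbit : ∀ {N} → ℕ → Mat N → Vec N → Vec N → Vec N → Set
SameOrbit d H b₁ v w =
  Σ (Mat _) λ p → InP d H b₁ p × Σ 𝔼 (λ c → (c ≢ 0E) × (act d v p ≈V scale d c w))

{-# OPTIONS --safe #-}
module Submission where

-- An element of P(ℚ) maps b₁ to a nonzero multiple of b₁ and preserves the form: so the line E b₁ is
-- fixed, and ⟪c₁,b₁⟫ = 0 ≠ ⟪b₂,b₁⟫ separates E c₁ from E b₂.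
-- Conversely, for isotropic e, u ⊥ e and ⟪u,u⟫ = s + s̄, the Eichler transformation
-- x ↦ x + ⟪x,e⟫ u − (⟪x,u⟫ + s ⟪x,e⟫) e is an isometry; it fixes b₁ when e, u ⊥ b₁, and such maps act
-- transitively on the isotropic z with ⟪z,e⟫ = 1 and a prescribed ⟪z,b₁⟫. Taking e = b₁ moves every
-- isotropic v with ⟪v,b₁⟫ ≠ 0 onto E b₂. If v ⊥ b₁ but v ∉ E b₁, nondegeneracy yields an Eichler
-- transformation along c₁ after which ⟪v,c₂⟫ ≠ 0, and then e = c₂ moves v onto E c₁.

open import Data.Empty using (⊥-elim)
open import Data.Fin using (Fin; zero; suc)
open import Data.Maybe using (Maybe; just; nothing)
open import Data.Nat as ℕ using (ℕ)
open import Data.Nat.Divisibility using (_∣0)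
open import Data.Nat.Properties using (0≢1+n)
open import Data.Fin.Properties using (all?; ¬∀⟶∃¬)
open import Data.Product as Product using (Σ; _×_; _,_; proj₁; proj₂)
open import Data.Sum using (_⊎_; inj₁; inj₂)
open import Function using (id)
open import Data.Rational as ℚ using (ℚ; 0ℚ; 1ℚ; ½)
import Data.Rational.Properties as ℚ
open import Data.Rational.Solver using (module +-*-Solver)
open import Relation.Binary.PropositionalEquality
open import Relation.Nullary using (¬_; Dec; yes; no)
open import Relation.Binary.Definitions using (DecidableEquality)
open import Algebra.Bundles using (CommutativeRing)
import Algebra.Solver.Ring as RingSolver
import Algebra.Solver.Ring.AlmostCommutativeRing as ACR

open import Defs

dℚ-positive : ∀ {d} → d ≢ 0 → ℚ.Positive (dℚ d)
dℚ-positive {ℕ.zero}  0≢0 = ⊥-elim (0≢0 refl)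
dℚ-positive {ℕ.suc k} _   = ℚ.normalize-pos (ℕ.suc k) 1

module QuadraticField (d : ℕ) where

  ≡-+√-d· : ∀ {a b a′ b′} → a ≡ a′ → b ≡ b′ → a +√-d· b ≡ a′ +√-d· b′
  ≡-+√-d· = cong₂ _+√-d·_

  negE : 𝔼 → 𝔼
  negE (a +√-d· b) = (ℚ.- a) +√-d· (ℚ.- b)

  private
    module Laws where
      open +-*-Solver

      D : ℚ
      D = dℚ d

      +-assoc : ∀ x y z → addE (addE x y) z ≡ addE x (addE y z)
      +-assoc (a +√-d· b) (a′ +√-d· b′) (a″ +√-d· b″) =
        ≡-+√-d· (ℚ.+-assoc a a′ a″) (ℚ.+-assoc b b′ b″)

      +-comm : ∀ x y → addE x y ≡ addE y x
      +-comm (a +√-d· b) (a′ +√-d· b′) = ≡-+√-d· (ℚ.+-comm a a′) (ℚ.+-comm b b′)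

      +-identityˡ : ∀ x → addE 0E x ≡ x
      +-identityˡ (a +√-d· b) = ≡-+√-d· (ℚ.+-identityˡ a) (ℚ.+-identityˡ b)

      +-identityʳ : ∀ x → addE x 0E ≡ x
      +-identityʳ x = trans (+-comm x 0E) (+-identityˡ x)

      -‿inverseˡ : ∀ x → addE (negE x) x ≡ 0E
      -‿inverseˡ (a +√-d· b) = ≡-+√-d· (ℚ.+-inverseˡ a) (ℚ.+-inverseˡ b)

      -‿inverseʳ : ∀ x → addE x (negE x) ≡ 0E
      -‿inverseʳ x = trans (+-comm x (negE x)) (-‿inverseˡ x)

      *-assoc : ∀ x y z → mulE d (mulE d x y) z ≡ mulE d x (mulE d y z)
      *-assoc (a +√-d· b) (a′ +√-d· b′) (a″ +√-d· b″) = ≡-+√-d·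
        (solve 7 (λ a b a′ b′ a″ b″ D →
            (a :* a′ :- D :* (b :* b′)) :* a″ :- D :* ((a :* b′ :+ b :* a′) :* b″)
         := a :* (a′ :* a″ :- D :* (b′ :* b″)) :- D :* (b :* (a′ :* b″ :+ b′ :* a″)))
          refl a b a′ b′ a″ b″ D)
        (solve 7 (λ a b a′ b′ a″ b″ D →
            (a :* a′ :- D :* (b :* b′)) :* b″ :+ (a :* b′ :+ b :* a′) :* a″
         := a :* (a′ :* b″ :+ b′ :* a″) :+ b :* (a′ :* a″ :- D :* (b′ :* b″)))
          refl a b a′ b′ a″ b″ D)

      *-comm : ∀ x y → mulE d x y ≡ mulE d y x
      *-comm (a +√-d· b) (a′ +√-d· b′) = ≡-+√-d·
        (solve 5 (λ a b a′ b′ D → a :* a′ :- D :* (b :* b′) := a′ :* a :- D :* (b′ :* b))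
          refl a b a′ b′ D)
        (solve 4 (λ a b a′ b′ → a :* b′ :+ b :* a′ := a′ :* b :+ b′ :* a) refl a b a′ b′)

      *-identityˡ : ∀ x → mulE d 1E x ≡ x
      *-identityˡ (a +√-d· b) = ≡-+√-d·
        (solve 3 (λ a b D → con 1ℚ :* a :- D :* (con 0ℚ :* b) := a) refl a b D)
        (solve 2 (λ a b → con 1ℚ :* b :+ con 0ℚ :* a := b) refl a b)

      *-identityʳ : ∀ x → mulE d x 1E ≡ x
      *-identityʳ x = trans (*-comm x 1E) (*-identityˡ x)

      distribʳ : ∀ x y z → mulE d (addE y z) x ≡ addE (mulE d y x) (mulE d z x)
      distribʳ (a +√-d· b) (a′ +√-d· b′) (a″ +√-d· b″) = ≡-+√-d·
        (solve 7 (λ a b a′ b′ a″ b″ D →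
            (a′ :+ a″) :* a :- D :* ((b′ :+ b″) :* b)
         := (a′ :* a :- D :* (b′ :* b)) :+ (a″ :* a :- D :* (b″ :* b)))
          refl a b a′ b′ a″ b″ D)
        (solve 6 (λ a b a′ b′ a″ b″ →
            (a′ :+ a″) :* b :+ (b′ :+ b″) :* a := (a′ :* b :+ b′ :* a) :+ (a″ :* b :+ b″ :* a))
          refl a b a′ b′ a″ b″)

      distribˡ : ∀ x y z → mulE d x (addE y z) ≡ addE (mulE d x y) (mulE d x z)
      distribˡ x y z = begin
        mulE d x (addE y z)                ≡⟨ *-comm x (addE y z) ⟩
        mulE d (addE y z) x                ≡⟨ distribʳ x y z ⟩
        addE (mulE d y x) (mulE d z x)     ≡⟨ cong₂ addE (*-comm y x) (*-comm z x) ⟩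
        addE (mulE d x y) (mulE d x z)     ∎
        where open ≡-Reasoning

  𝔼-commutativeRing : CommutativeRing _ _
  𝔼-commutativeRing = record
    { Carrier = 𝔼
    ; _≈_ = _≡_
    ; _+_ = addE
    ; _*_ = mulE d
    ; -_ = negE
    ; 0# = 0E
    ; 1# = 1E
    ; isCommutativeRing = record
      { isRing = record
        { +-isAbelianGroup = record
          { isGroup = record
            { isMonoid = record
              { isSemigroup = record
                { isMagma = record { isEquivalence = isEquivalence ; ∙-cong = cong₂ addE }
                ; assoc = Laws.+-assoc }
              ; identity = Laws.+-identityˡ , Laws.+-identityʳ }
            ; inverse = Laws.-‿inverseˡ , Laws.-‿inverseʳ
            ; ⁻¹-cong = cong negE }
          ; comm = Laws.+-comm }
        ; *-cong = cong₂ (mulE d)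
        ; *-assoc = Laws.*-assoc
        ; *-identity = Laws.*-identityˡ , Laws.*-identityʳ
        ; distrib = Laws.distribˡ , Laws.distribʳ }
      ; *-comm = Laws.*-comm } }

  open CommutativeRing 𝔼-commutativeRing public
    using (_+_; _*_; -_; *-comm; *-assoc; *-identityˡ; *-identityʳ; zeroˡ; zeroʳ; +-identityˡ; +-identityʳ; semiring)

  ι : ℚ → 𝔼
  ι q = q +√-d· 0ℚ

  private
    ι-homomorphism : ℚ.+-*-rawRing ACR.-Raw-AlmostCommutative⟶ ACR.fromCommutativeRing 𝔼-commutativeRing
    ι-homomorphism = record
      { ⟦_⟧ = ι
      ; +-homo = λ p q → ≡-+√-d· refl (sym (ℚ.+-identityˡ 0ℚ))
      ; *-homo = λ p q → ≡-+√-d·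
          (solve 3 (λ p q D → p :* q := p :* q :- D :* (con 0ℚ :* con 0ℚ)) refl p q (dℚ d))
          (solve 2 (λ p q → con 0ℚ := p :* con 0ℚ :+ con 0ℚ :* q) refl p q)
      ; -‿homo = λ p → refl
      ; 0-homo = refl
      ; 1-homo = refl }
      where open +-*-Solver

    ι-equal? : (p q : ℚ) → Maybe (ι p ≡ ι q)
    ι-equal? p q with p ℚ.≟ q
    ... | yes p≡q = just (cong ι p≡q)
    ... | no _    = nothing

  conj-+ : ∀ x y → conj (x + y) ≡ conj x + conj y
  conj-+ (a +√-d· b) (a′ +√-d· b′) = ≡-+√-d· refl (ℚ.neg-distrib-+ b b′)

  conj-* : ∀ x y → conj (x * y) ≡ conj x * conj y
  conj-* (a +√-d· b) (a′ +√-d· b′) = ≡-+√-d·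
    (solve 5 (λ a b a′ b′ D → a :* a′ :- D :* (b :* b′) := a :* a′ :- D :* ((:- b) :* (:- b′)))
      refl a b a′ b′ (dℚ d))
    (solve 4 (λ a b a′ b′ → :- (a :* b′ :+ b :* a′) := a :* (:- b′) :+ (:- b) :* a′) refl a b a′ b′)
    where open +-*-Solver

  conj-involutive : ∀ x → conj (conj x) ≡ x
  conj-involutive (a +√-d· b) = ≡-+√-d· refl (solve 1 (λ b → :- (:- b) := b) refl b)
    where open +-*-Solver

  conj-≢0 : ∀ {x} → x ≢ 0E → conj x ≢ 0E
  conj-≢0 {x} x≢0 conjx≡0 = x≢0 (trans (sym (conj-involutive x)) (cong conj conjx≡0))

  infix 4 _≟_
  _≟_ : DecidableEquality 𝔼
  (a +√-d· b) ≟ (a′ +√-d· b′) with a ℚ.≟ a′ | b ℚ.≟ b′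
  ... | yes a≡a′ | yes b≡b′ = yes (≡-+√-d· a≡a′ b≡b′)
  ... | no a≢a′  | _        = no (λ x≡x′ → a≢a′ (cong re x≡x′))
  ... | _        | no b≢b′  = no (λ x≡x′ → b≢b′ (cong im x≡x′))

  1≢0 : 1E ≢ 0E
  1≢0 ()

  √-d : 𝔼
  √-d = 0ℚ +√-d· 1ℚ

  √-d+conj√-d≡0 : √-d + conj √-d ≡ 0E
  √-d+conj√-d≡0 = ≡-+√-d· (ℚ.+-identityˡ 0ℚ) (ℚ.+-inverseʳ 1ℚ)

  module Inverse (d≢0 : d ≢ 0) where
    open import Data.Integer using (+_; +[1+_]; -[1+_])

    private
      D : ℚ
      D = dℚ d

      D-positive : ℚ.Positive D
      D-positive = dℚ-positive d≢0

      square-nonNegative : ∀ p → ℚ.NonNegative (p ℚ.* p)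
      square-nonNegative p@(ℚ.mkℚ (+ _) _ _)    = ℚ.nonNeg*nonNeg⇒nonNeg p p
      square-nonNegative p@(ℚ.mkℚ -[1+ _ ] _ _) =
        ℚ.nonPos*nonPos⇒nonPos p {{ℚ.neg⇒nonPos p}} p {{ℚ.neg⇒nonPos p}}

      square-positive : ∀ p → p ≢ 0ℚ → ℚ.Positive (p ℚ.* p)
      square-positive p@(ℚ.mkℚ +[1+ _ ] _ _) _  = ℚ.pos*pos⇒pos p p
      square-positive p@(ℚ.mkℚ -[1+ _ ] _ _) _  = ℚ.neg*neg⇒pos p p
      square-positive p@(ℚ.mkℚ (+ 0) _ _) p≢0 = ⊥-elim (p≢0 (ℚ.↥p≡0⇒p≡0 p refl))

    norm : 𝔼 → ℚ
    norm (a +√-d· b) = a ℚ.* a ℚ.+ D ℚ.* (b ℚ.* b)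

    norm-positive : ∀ x → x ≢ 0E → ℚ.Positive (norm x)
    norm-positive (a +√-d· b) x≢0 with a ℚ.≟ 0ℚ
    ... | no a≢0 = ℚ.pos+nonNeg⇒pos (a ℚ.* a) {{square-positive a a≢0}} (D ℚ.* (b ℚ.* b))
        {{ℚ.nonNeg*nonNeg⇒nonNeg D {{ℚ.pos⇒nonNeg D {{D-positive}}}} (b ℚ.* b) {{square-nonNegative b}}}}
    ... | yes refl = ℚ.nonNeg+pos⇒pos (a ℚ.* a) {{square-nonNegative a}} (D ℚ.* (b ℚ.* b))
        {{ℚ.pos*pos⇒pos D {{D-positive}} (b ℚ.* b) {{square-positive b (λ b≡0 → x≢0 (≡-+√-d· refl b≡0))}}}}

    inverse : ∀ x → x ≢ 0E → Σ 𝔼 (λ y → x * y ≡ 1E)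
    inverse x@(a +√-d· b) x≢0 = (a ℚ.* r) +√-d· ((ℚ.- b) ℚ.* r) , ≡-+√-d·
      (trans (solve 4 (λ a b r D → a :* (a :* r) :- D :* (b :* ((:- b) :* r)) := (a :* a :+ D :* (b :* b)) :* r)
               refl a b r D)
             (ℚ.*-inverseʳ (norm x)))
      (solve 3 (λ a b r → a :* ((:- b) :* r) :+ b :* (a :* r) := con 0ℚ) refl a b r)
      where
        open +-*-Solver
        instance
          norm≢0 : ℚ.NonZero (norm x)
          norm≢0 = ℚ.pos⇒nonZero (norm x) {{norm-positive x x≢0}}
        r : ℚ
        r = ℚ.1/ norm x

    x*y≡0⇒y≡0 : ∀ {x y} → x ≢ 0E → x * y ≡ 0E → y ≡ 0E
    x*y≡0⇒y≡0 {x} {y} x≢0 xy≡0 = begin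
      y               ≡⟨ sym (*-identityˡ y) ⟩
      1E * y          ≡⟨ cong (_* y) (trans (sym xx⁻¹≡1) (*-comm x x⁻¹)) ⟩
      x⁻¹ * x * y     ≡⟨ *-assoc x⁻¹ x y ⟩
      x⁻¹ * (x * y)   ≡⟨ cong (x⁻¹ *_) xy≡0 ⟩
      x⁻¹ * 0E        ≡⟨ zeroʳ x⁻¹ ⟩
      0E              ∎
      where
        open ≡-Reasoning
        x⁻¹ : 𝔼
        x⁻¹ = proj₁ (inverse x x≢0)
        xx⁻¹≡1 : x * x⁻¹ ≡ 1E
        xx⁻¹≡1 = proj₂ (inverse x x≢0)

  module 𝔼-Solver = RingSolver ℚ.+-*-rawRing (ACR.fromCommutativeRing 𝔼-commutativeRing) ι-homomorphism ι-equal?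
  open 𝔼-Solver public using (solve; _:+_; _:*_; :-_; _:=_; con)

  ½*x+conj[½*x]≡x : ∀ x → conj x ≡ x → ι ½ * x + conj (ι ½ * x) ≡ x
  ½*x+conj[½*x]≡x x conj-x≡x = begin
    ι ½ * x + conj (ι ½ * x)    ≡⟨ cong (ι ½ * x +_) (trans (conj-* (ι ½) x) (cong (ι ½ *_) conj-x≡x)) ⟩
    ι ½ * x + ι ½ * x           ≡⟨ solve 1 (λ x → con ½ :* x :+ con ½ :* x := x) refl x ⟩
    x                           ∎
    where open ≡-Reasoning

module HermitianSpace (d : ℕ) (d≢0 : d ≢ 0) {N : ℕ} (H : Mat N) (herm : IsHermitian H) where
  open QuadraticField d public
  open Inverse d≢0 public
  open import Algebra.Properties.Semiring.Sum semiring
  open ≡-Reasoning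

  V : Set
  V = Defs.Vec N

  infixl 6 _+ᵥ_
  infixr 7 _·_

  _+ᵥ_ : V → V → V
  (x +ᵥ y) i = x i + y i

  _·_ : 𝔼 → V → V
  _·_ = scale d

  0ᵥ : V
  0ᵥ _ = 0E

  ∑ᵥ : ∀ {M} → (Fin M → V) → V
  ∑ᵥ f j = ∑[ i < _ ] f i j

  ⟪_,_⟫ : V → V → 𝔼
  ⟪_,_⟫ = form d H

  sumE≡sum : ∀ {n} (f : Fin n → 𝔼) → sumE f ≡ sum f
  sumE≡sum {ℕ.zero}  f = refl
  sumE≡sum {ℕ.suc n} f = cong (f zero +_) (sumE≡sum (λ i → f (suc i)))

  conj-∑ : ∀ {n} (f : Fin n → 𝔼) → conj (sum f) ≡ ∑[ i < n ] conj (f i)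
  conj-∑ {ℕ.zero}  f = refl
  conj-∑ {ℕ.suc n} f =
    trans (conj-+ (f zero) (sum (λ i → f (suc i)))) (cong (conj (f zero) +_) (conj-∑ (λ i → f (suc i))))

  entry : V → V → Fin N → Fin N → 𝔼
  entry x y i j = x i * H i j * conj (y j)

  form≡∑∑ : ∀ x y → ⟪ x , y ⟫ ≡ ∑[ i < N ] ∑[ j < N ] entry x y i j
  form≡∑∑ x y = trans (sumE≡sum (λ i → sumE (entry x y i))) (sum-cong-≗ (λ i → sumE≡sum (entry x y i)))

  form-cong : ∀ {x x′ y y′} → x ≈V x′ → y ≈V y′ → ⟪ x , y ⟫ ≡ ⟪ x′ , y′ ⟫
  form-cong {x} {x′} {y} {y′} x≈x′ y≈y′ = begin
    ⟪ x , y ⟫                                ≡⟨ form≡∑∑ x y ⟩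
    ∑[ i < N ] ∑[ j < N ] entry x y i j
      ≡⟨ sum-cong-≗ (λ i → sum-cong-≗ (λ j → cong₂ (λ a b → a * H i j * conj b) (x≈x′ i) (y≈y′ j))) ⟩
    ∑[ i < N ] ∑[ j < N ] entry x′ y′ i j    ≡⟨ form≡∑∑ x′ y′ ⟨
    ⟪ x′ , y′ ⟫                              ∎

  form-congˡ : ∀ {x x′} y → x ≈V x′ → ⟪ x , y ⟫ ≡ ⟪ x′ , y ⟫
  form-congˡ {x} {x′} y x≈x′ = form-cong {x} {x′} {y} {y} x≈x′ (λ _ → refl)

  form-congʳ : ∀ x {y y′} → y ≈V y′ → ⟪ x , y ⟫ ≡ ⟪ x , y′ ⟫
  form-congʳ x {y} {y′} y≈y′ = form-cong {x} {x} {y} {y′} (λ _ → refl) y≈y′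

  form-+ˡ : ∀ x y z → ⟪ x +ᵥ y , z ⟫ ≡ ⟪ x , z ⟫ + ⟪ y , z ⟫
  form-+ˡ x y z = begin
    ⟪ x +ᵥ y , z ⟫                                   ≡⟨ form≡∑∑ (x +ᵥ y) z ⟩
    ∑[ i < N ] ∑[ j < N ] entry (x +ᵥ y) z i j
      ≡⟨ sum-cong-≗ (λ i → trans (sum-cong-≗ (λ j → distrib₃ (x i) (y i) (H i j) (conj (z j))))
                                  (∑-distrib-+ (entry x z i) (entry y z i))) ⟩
    ∑[ i < N ] (sum (entry x z i) + sum (entry y z i))
      ≡⟨ ∑-distrib-+ (λ i → sum (entry x z i)) (λ i → sum (entry y z i)) ⟩
    ∑[ i < N ] ∑[ j < N ] entry x z i j + ∑[ i < N ] ∑[ j < N ] entry y z i j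
      ≡⟨ cong₂ _+_ (form≡∑∑ x z) (form≡∑∑ y z) ⟨
    ⟪ x , z ⟫ + ⟪ y , z ⟫ ∎
    where
      distrib₃ : ∀ a b h c → (a + b) * h * c ≡ a * h * c + b * h * c
      distrib₃ = solve 4 (λ a b h c → (a :+ b) :* h :* c := a :* h :* c :+ b :* h :* c) refl

  form-·ˡ : ∀ c x z → ⟪ c · x , z ⟫ ≡ c * ⟪ x , z ⟫
  form-·ˡ c x z = begin
    ⟪ c · x , z ⟫                                    ≡⟨ form≡∑∑ (c · x) z ⟩
    ∑[ i < N ] ∑[ j < N ] entry (c · x) z i j
      ≡⟨ sum-cong-≗ (λ i → trans (sum-cong-≗ (λ j → assoc₃ c (x i) (H i j) (conj (z j))))
                                  (sym (*-distribˡ-sum c (entry x z i)))) ⟩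
    ∑[ i < N ] (c * sum (entry x z i))               ≡⟨ *-distribˡ-sum c (λ i → sum (entry x z i)) ⟨
    c * ∑[ i < N ] ∑[ j < N ] entry x z i j          ≡⟨ cong (c *_) (form≡∑∑ x z) ⟨
    c * ⟪ x , z ⟫                                    ∎
    where
      assoc₃ : ∀ c a h k → c * a * h * k ≡ c * (a * h * k)
      assoc₃ = solve 4 (λ c a h k → c :* a :* h :* k := c :* (a :* h :* k)) refl

  form-conj : ∀ x y → ⟪ y , x ⟫ ≡ conj ⟪ x , y ⟫
  form-conj x y = begin
    ⟪ y , x ⟫                                           ≡⟨ form≡∑∑ y x ⟩
    ∑[ j < N ] ∑[ i < N ] entry y x j i                 ≡⟨ ∑-comm (entry y x) ⟩
    ∑[ i < N ] ∑[ j < N ] entry y x j i                 ≡⟨ sum-cong-≗ (λ i → sum-cong-≗ (entry-conj i)) ⟩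
    ∑[ i < N ] ∑[ j < N ] conj (entry x y i j)
      ≡⟨ trans (conj-∑ (λ i → sum (entry x y i))) (sum-cong-≗ (λ i → conj-∑ (entry x y i))) ⟨
    conj (∑[ i < N ] ∑[ j < N ] entry x y i j)          ≡⟨ cong conj (form≡∑∑ x y) ⟨
    conj ⟪ x , y ⟫                                      ∎
    where
      entry-conj : ∀ i j → entry y x j i ≡ conj (entry x y i j)
      entry-conj i j = begin
        y j * H j i * conj (x i)                 ≡⟨ cong (λ h → y j * h * conj (x i)) (herm i j) ⟩
        y j * conj (H i j) * conj (x i)
          ≡⟨ solve 3 (λ a h b → b :* h :* a := a :* h :* b) refl (conj (x i)) (conj (H i j)) (y j) ⟩
        conj (x i) * conj (H i j) * y j          ≡⟨ cong (conj (x i) * conj (H i j) *_) (conj-involutive (y j)) ⟨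
        conj (x i) * conj (H i j) * conj (conj (y j))
          ≡⟨ trans (conj-* (x i * H i j) (conj (y j))) (cong (_* conj (conj (y j))) (conj-* (x i) (H i j))) ⟨
        conj (x i * H i j * conj (y j)) ∎

  form-swap : ∀ x y {a} → ⟪ x , y ⟫ ≡ a → ⟪ y , x ⟫ ≡ conj a
  form-swap x y ⟪x,y⟫≡a = trans (form-conj x y) (cong conj ⟪x,y⟫≡a)

  form-+ʳ : ∀ x y z → ⟪ z , x +ᵥ y ⟫ ≡ ⟪ z , x ⟫ + ⟪ z , y ⟫
  form-+ʳ x y z = begin
    ⟪ z , x +ᵥ y ⟫                   ≡⟨ form-conj (x +ᵥ y) z ⟩
    conj ⟪ x +ᵥ y , z ⟫              ≡⟨ cong conj (form-+ˡ x y z) ⟩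
    conj (⟪ x , z ⟫ + ⟪ y , z ⟫)     ≡⟨ conj-+ ⟪ x , z ⟫ ⟪ y , z ⟫ ⟩
    conj ⟪ x , z ⟫ + conj ⟪ y , z ⟫  ≡⟨ cong₂ _+_ (form-conj x z) (form-conj y z) ⟨
    ⟪ z , x ⟫ + ⟪ z , y ⟫            ∎

  form-·ʳ : ∀ c x z → ⟪ z , c · x ⟫ ≡ conj c * ⟪ z , x ⟫
  form-·ʳ c x z = begin
    ⟪ z , c · x ⟫           ≡⟨ form-conj (c · x) z ⟩
    conj ⟪ c · x , z ⟫      ≡⟨ cong conj (form-·ˡ c x z) ⟩
    conj (c * ⟪ x , z ⟫)    ≡⟨ conj-* c ⟪ x , z ⟫ ⟩
    conj c * conj ⟪ x , z ⟫ ≡⟨ cong (conj c *_) (form-conj x z) ⟨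
    conj c * ⟪ z , x ⟫      ∎

  form-0ˡ : ∀ z → ⟪ 0ᵥ , z ⟫ ≡ 0E
  form-0ˡ z = begin
    ⟪ 0ᵥ , z ⟫       ≡⟨ form-congˡ z (λ i → sym (zeroˡ (z i))) ⟩
    ⟪ 0E · z , z ⟫   ≡⟨ form-·ˡ 0E z z ⟩
    0E * ⟪ z , z ⟫   ≡⟨ zeroˡ ⟪ z , z ⟫ ⟩
    0E               ∎

  form-0ʳ : ∀ z → ⟪ z , 0ᵥ ⟫ ≡ 0E
  form-0ʳ z = form-swap 0ᵥ z (form-0ˡ z)

  form-combˡ : ∀ x a y b z w → ⟪ x +ᵥ a · y +ᵥ b · z , w ⟫ ≡ ⟪ x , w ⟫ + a * ⟪ y , w ⟫ + b * ⟪ z , w ⟫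
  form-combˡ x a y b z w = begin
    ⟪ x +ᵥ a · y +ᵥ b · z , w ⟫                     ≡⟨ form-+ˡ (x +ᵥ a · y) (b · z) w ⟩
    ⟪ x +ᵥ a · y , w ⟫ + ⟪ b · z , w ⟫               ≡⟨ cong₂ _+_ (form-+ˡ x (a · y) w) (form-·ˡ b z w) ⟩
    ⟪ x , w ⟫ + ⟪ a · y , w ⟫ + b * ⟪ z , w ⟫        ≡⟨ cong (λ t → ⟪ x , w ⟫ + t + b * ⟪ z , w ⟫) (form-·ˡ a y w) ⟩
    ⟪ x , w ⟫ + a * ⟪ y , w ⟫ + b * ⟪ z , w ⟫        ∎

  form-combʳ : ∀ x a y b z w →
               ⟪ w , x +ᵥ a · y +ᵥ b · z ⟫ ≡ ⟪ w , x ⟫ + conj a * ⟪ w , y ⟫ + conj b * ⟪ w , z ⟫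
  form-combʳ x a y b z w = begin
    ⟪ w , x +ᵥ a · y +ᵥ b · z ⟫
      ≡⟨ form-+ʳ (x +ᵥ a · y) (b · z) w ⟩
    ⟪ w , x +ᵥ a · y ⟫ + ⟪ w , b · z ⟫
      ≡⟨ cong₂ _+_ (form-+ʳ x (a · y) w) (form-·ʳ b z w) ⟩
    ⟪ w , x ⟫ + ⟪ w , a · y ⟫ + conj b * ⟪ w , z ⟫
      ≡⟨ cong (λ t → ⟪ w , x ⟫ + t + conj b * ⟪ w , z ⟫) (form-·ʳ a y w) ⟩
    ⟪ w , x ⟫ + conj a * ⟪ w , y ⟫ + conj b * ⟪ w , z ⟫ ∎

  ·≈·⇒form≡ : ∀ a x b y → (a · x) ≈V (b · y) → ∀ z → a * ⟪ x , z ⟫ ≡ b * ⟪ y , z ⟫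
  ·≈·⇒form≡ a x b y ax≈by z = trans (sym (form-·ˡ a x z)) (trans (form-congˡ z ax≈by) (form-·ˡ b y z))

  form-∑ʳ : ∀ {M} x (f : Fin M → V) → ⟪ x , ∑ᵥ f ⟫ ≡ ∑[ j < M ] ⟪ x , f j ⟫
  form-∑ʳ {ℕ.zero}  x f = form-0ʳ x
  form-∑ʳ {ℕ.suc M} x f = trans (form-+ʳ (f zero) (∑ᵥ (λ i → f (suc i))) x)
                                (cong (⟪ x , f zero ⟫ +_) (form-∑ʳ x (λ i → f (suc i))))

  δ : ∀ {n} → Fin n → Fin n → 𝔼
  δ zero    zero    = 1E
  δ zero    (suc _) = 0E
  δ (suc _) zero    = 0E
  δ (suc i) (suc j) = δ i j

  ∑-δ : ∀ {n} (x : Fin n → 𝔼) j → ∑[ i < n ] (x i * δ i j) ≡ x j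
  ∑-δ {ℕ.suc n} x zero = begin
    x zero * 1E + ∑[ i < n ] (x (suc i) * 0E)
      ≡⟨ cong₂ _+_ (*-identityʳ (x zero)) (trans (sum-cong-≗ (λ i → zeroʳ (x (suc i)))) (sum-replicate-zero n)) ⟩
    x zero + 0E ≡⟨ +-identityʳ (x zero) ⟩
    x zero ∎
  ∑-δ {ℕ.suc n} x (suc j) =
    trans (cong₂ _+_ (zeroʳ (x zero)) (∑-δ (λ i → x (suc i)) j)) (+-identityˡ (x (suc j)))

  basis-expansion : ∀ x → x ≈V ∑ᵥ (λ i → x i · δ i)
  basis-expansion x j = sym (∑-δ x j)

  orthogonal-to-basis⇒orthogonal : ∀ x → (∀ j → ⟪ x , δ j ⟫ ≡ 0E) → ∀ y → ⟪ x , y ⟫ ≡ 0E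
  orthogonal-to-basis⇒orthogonal x x⊥δ y = begin
    ⟪ x , y ⟫                              ≡⟨ form-congʳ x (basis-expansion y) ⟩
    ⟪ x , ∑ᵥ (λ j → y j · δ j) ⟫           ≡⟨ form-∑ʳ x (λ j → y j · δ j) ⟩
    ∑[ j < N ] ⟪ x , y j · δ j ⟫
      ≡⟨ sum-cong-≗ (λ j → trans (form-·ʳ (y j) (δ j) x) (trans (cong (conj (y j) *_) (x⊥δ j)) (zeroʳ (conj (y j))))) ⟩
    ∑[ j < N ] 0E                          ≡⟨ sum-replicate-zero N ⟩
    0E                                     ∎

  nondegenerate-witness : Nondegenerate d H → ∀ x → ¬ IsZeroV x → Σ V (λ y → ⟪ x , y ⟫ ≢ 0E)
  nondegenerate-witness nondeg x x≢0 =
    Product.map δ id (¬∀⟶∃¬ N _ (λ j → ⟪ x , δ j ⟫ ≟ 0E) x-not-orthogonal-to-basis)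
    where
      x-not-orthogonal-to-basis : ¬ (∀ j → ⟪ x , δ j ⟫ ≡ 0E)
      x-not-orthogonal-to-basis x⊥δ = x≢0 (nondeg x (orthogonal-to-basis⇒orthogonal x x⊥δ))

  record IsLinear (T : V → V) : Set where
    field
      ≈-cong : ∀ {x y} → x ≈V y → T x ≈V T y
      +-homo : ∀ x y → T (x +ᵥ y) ≈V (T x +ᵥ T y)
      ·-homo : ∀ c x → T (c · x) ≈V (c · T x)

  matrix : (V → V) → Mat N
  matrix T i j = T (δ i) j

  module _ {T : V → V} (T-linear : IsLinear T) where
    open IsLinear T-linear

    linear-0 : T 0ᵥ ≈V 0ᵥ
    linear-0 j = begin
      T 0ᵥ j         ≡⟨ ≈-cong {0ᵥ} {0E · 0ᵥ} (λ _ → sym (zeroˡ 0E)) j ⟩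
      T (0E · 0ᵥ) j  ≡⟨ ·-homo 0E 0ᵥ j ⟩
      0E * T 0ᵥ j    ≡⟨ zeroˡ (T 0ᵥ j) ⟩
      0E             ∎

    linear-∑ : ∀ {M} (f : Fin M → V) → T (∑ᵥ f) ≈V ∑ᵥ (λ i → T (f i))
    linear-∑ {ℕ.zero}  f = linear-0
    linear-∑ {ℕ.suc M} f j = begin
      T (∑ᵥ f) j                                 ≡⟨ +-homo (f zero) (∑ᵥ (λ i → f (suc i))) j ⟩
      T (f zero) j + T (∑ᵥ (λ i → f (suc i))) j  ≡⟨ cong (T (f zero) j +_) (linear-∑ (λ i → f (suc i)) j) ⟩
      ∑ᵥ (λ i → T (f i)) j                       ∎

    act-matrix : ∀ x → act d x (matrix T) ≈V T x
    act-matrix x j = begin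
      act d x (matrix T) j          ≡⟨ sumE≡sum (λ i → x i * T (δ i) j) ⟩
      ∑[ i < N ] (x i * T (δ i) j)  ≡⟨ sum-cong-≗ (λ i → ·-homo (x i) (δ i) j) ⟨
      ∑ᵥ (λ i → T (x i · δ i)) j    ≡⟨ linear-∑ (λ i → x i · δ i) j ⟨
      T (∑ᵥ (λ i → x i · δ i)) j    ≡⟨ ≈-cong (basis-expansion x) j ⟨
      T x j                         ∎

  record UnitaryFixing (b : V) : Set where
    field
      map map⁻¹      : V → V
      map-linear     : IsLinear map
      map⁻¹-linear   : IsLinear map⁻¹
      map⁻¹∘map      : ∀ x → map⁻¹ (map x) ≈V x
      map∘map⁻¹      : ∀ x → map (map⁻¹ x) ≈V x
      isometry       : ∀ x y → ⟪ map x , map y ⟫ ≡ ⟪ x , y ⟫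
      fixes          : map b ≈V b

  module _ {b : V} where
    open UnitaryFixing
    open IsLinear

    unitaryFixing⇒InP : (g : UnitaryFixing b) → InP d H b (matrix (map g))
    unitaryFixing⇒InP g = (preserves-form , matrix (map⁻¹ g) , inverses) , 1E , fixes-b
      where
        g-act = act-matrix (map-linear g)
        g⁻¹-act = act-matrix (map⁻¹-linear g)
        preserves-form : ∀ x y → ⟪ act d x (matrix (map g)) , act d y (matrix (map g)) ⟫ ≡ ⟪ x , y ⟫
        preserves-form x y = trans (form-cong (g-act x) (g-act y)) (isometry g x y)
        inverses : ∀ x → (act d (act d x (matrix (map g))) (matrix (map⁻¹ g)) ≈V x)
                       × (act d (act d x (matrix (map⁻¹ g))) (matrix (map g)) ≈V x)
        inverses x =
          (λ j → trans (g⁻¹-act _ j) (trans (≈-cong (map⁻¹-linear g) (g-act x) j) (map⁻¹∘map g x j))) ,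
          (λ j → trans (g-act _ j) (trans (≈-cong (map-linear g) (g⁻¹-act x) j) (map∘map⁻¹ g x j)))
        fixes-b : act d b (matrix (map g)) ≈V (1E · b)
        fixes-b j = trans (g-act b j) (trans (fixes g j) (sym (*-identityˡ (b j))))

    sameOrbit : ∀ (g : UnitaryFixing b) v w {c} → c ≢ 0E → map g v ≈V (c · w) → SameOrbit d H b v w
    sameOrbit g v w c≢0 gv≈cw =
      matrix (map g) , unitaryFixing⇒InP g , _ , c≢0 , λ j → trans (act-matrix (map-linear g) v j) (gv≈cw j)

    idᵘ : UnitaryFixing b
    idᵘ = record
      { map = λ x → x ; map⁻¹ = λ x → x ; map-linear = id-linear ; map⁻¹-linear = id-linear
      ; map⁻¹∘map = λ _ _ → refl ; map∘map⁻¹ = λ _ _ → refl ; isometry = λ _ _ → refl ; fixes = λ _ → refl }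
      where
        id-linear : IsLinear (λ x → x)
        id-linear = record { ≈-cong = λ x≈y → x≈y ; +-homo = λ _ _ _ → refl ; ·-homo = λ _ _ _ → refl }

    infixr 9 _∘ᵘ_
    _∘ᵘ_ : UnitaryFixing b → UnitaryFixing b → UnitaryFixing b
    h ∘ᵘ g = record
      { map = λ x → map h (map g x)
      ; map⁻¹ = λ x → map⁻¹ g (map⁻¹ h x)
      ; map-linear = ∘-linear (map-linear h) (map-linear g)
      ; map⁻¹-linear = ∘-linear (map⁻¹-linear g) (map⁻¹-linear h)
      ; map⁻¹∘map = λ x j → trans (≈-cong (map⁻¹-linear g) (map⁻¹∘map h (map g x)) j) (map⁻¹∘map g x j)
      ; map∘map⁻¹ = λ x j → trans (≈-cong (map-linear h) (map∘map⁻¹ g (map⁻¹ h x)) j) (map∘map⁻¹ h x j)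
      ; isometry = λ x y → trans (isometry h (map g x) (map g y)) (isometry g x y)
      ; fixes = λ j → trans (≈-cong (map-linear h) (fixes g) j) (fixes h j) }
      where
        ∘-linear : ∀ {S T} → IsLinear S → IsLinear T → IsLinear (λ x → S (T x))
        ∘-linear S-lin T-lin = record
          { ≈-cong = λ x≈y → ≈-cong S-lin (≈-cong T-lin x≈y)
          ; +-homo = λ x y j → trans (≈-cong S-lin (+-homo T-lin x y) j) (+-homo S-lin _ _ j)
          ; ·-homo = λ c x j → trans (≈-cong S-lin (·-homo T-lin c x) j) (·-homo S-lin c _ j) }

  module Eichler (e : V) (e-isotropic : ⟪ e , e ⟫ ≡ 0E) where
    open UnitaryFixing using (map)

    eichler : V → 𝔼 → V → V
    eichler u s x = x +ᵥ ⟪ x , e ⟫ · u +ᵥ (- (⟪ x , u ⟫ + s * ⟪ x , e ⟫)) · e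

    eichler-linear : ∀ u s → IsLinear (eichler u s)
    eichler-linear u s = record
      { ≈-cong = λ {x} {y} x≈y j → trans (cong (λ a → at j a ⟪ x , e ⟫ ⟪ x , u ⟫) (x≈y j))
                                         (cong₂ (at j (y j)) (form-congˡ e x≈y) (form-congˡ u x≈y))
      ; +-homo = λ x y j → trans (cong₂ (at j (x j + y j)) (form-+ˡ x y e) (form-+ˡ x y u))
                                 (at-+ (x j) (y j) ⟪ x , e ⟫ ⟪ y , e ⟫ ⟪ x , u ⟫ ⟪ y , u ⟫ s (u j) (e j))
      ; ·-homo = λ c x j → trans (cong₂ (at j (c * x j)) (form-·ˡ c x e) (form-·ˡ c x u))
                                 (at-· c (x j) ⟪ x , e ⟫ ⟪ x , u ⟫ s (u j) (e j)) }
      where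
        at : Fin N → 𝔼 → 𝔼 → 𝔼 → 𝔼
        at j a α μ = a + α * u j + (- (μ + s * α)) * e j
        at-+ : ∀ a b α β μ ν s U E →
               a + b + (α + β) * U + (- (μ + ν + s * (α + β))) * E
               ≡ a + α * U + (- (μ + s * α)) * E + (b + β * U + (- (ν + s * β)) * E)
        at-+ = solve 9 (λ a b α β μ ν s U E →
                 a :+ b :+ (α :+ β) :* U :+ (:- (μ :+ ν :+ s :* (α :+ β))) :* E
              := a :+ α :* U :+ (:- (μ :+ s :* α)) :* E :+ (b :+ β :* U :+ (:- (ν :+ s :* β)) :* E)) refl
        at-· : ∀ c a α μ s U E →
               c * a + c * α * U + (- (c * μ + s * (c * α))) * E ≡ c * (a + α * U + (- (μ + s * α)) * E)
        at-· = solve 7 (λ c a α μ s U E →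
                 c :* a :+ c :* α :* U :+ (:- (c :* μ :+ s :* (c :* α))) :* E
              := c :* (a :+ α :* U :+ (:- (μ :+ s :* α)) :* E)) refl

    module _ {u : V} {s : 𝔼} (u⊥e : ⟪ u , e ⟫ ≡ 0E) where

      form-eichler-e : ∀ x → ⟪ eichler u s x , e ⟫ ≡ ⟪ x , e ⟫
      form-eichler-e x = begin
        ⟪ eichler u s x , e ⟫
          ≡⟨ form-combˡ x α u β e e ⟩
        ⟪ x , e ⟫ + α * ⟪ u , e ⟫ + β * ⟪ e , e ⟫
          ≡⟨ cong₂ (λ p q → ⟪ x , e ⟫ + α * p + β * q) u⊥e e-isotropic ⟩
        ⟪ x , e ⟫ + α * 0E + β * 0E
          ≡⟨ solve 3 (λ X α β → X :+ α :* con 0ℚ :+ β :* con 0ℚ := X) refl ⟪ x , e ⟫ α β ⟩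
        ⟪ x , e ⟫ ∎
        where
          α = ⟪ x , e ⟫
          β = - (⟪ x , u ⟫ + s * α)

      form-eichler-u : ∀ x → ⟪ eichler u s x , u ⟫ ≡ ⟪ x , u ⟫ + ⟪ x , e ⟫ * ⟪ u , u ⟫
      form-eichler-u x = begin
        ⟪ eichler u s x , u ⟫
          ≡⟨ form-combˡ x α u β e u ⟩
        ⟪ x , u ⟫ + α * ⟪ u , u ⟫ + β * ⟪ e , u ⟫
          ≡⟨ cong (λ p → ⟪ x , u ⟫ + α * ⟪ u , u ⟫ + β * p) (form-swap u e u⊥e) ⟩
        ⟪ x , u ⟫ + α * ⟪ u , u ⟫ + β * 0E
          ≡⟨ solve 3 (λ X Y β → X :+ Y :+ β :* con 0ℚ := X :+ Y) refl ⟪ x , u ⟫ (α * ⟪ u , u ⟫) β ⟩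
        ⟪ x , u ⟫ + α * ⟪ u , u ⟫ ∎
        where
          α = ⟪ x , e ⟫
          β = - (⟪ x , u ⟫ + s * α)

      eichler-isometry : ⟪ u , u ⟫ ≡ s + conj s → ∀ x y → ⟪ eichler u s x , eichler u s y ⟫ ≡ ⟪ x , y ⟫
      eichler-isometry u-norm x y = begin
        ⟪ Ex , eichler u s y ⟫
          ≡⟨ form-combʳ y α′ u β′ e Ex ⟩
        ⟪ Ex , y ⟫ + conj α′ * ⟪ Ex , u ⟫ + conj β′ * ⟪ Ex , e ⟫
          ≡⟨ cong₂ (λ p q → ⟪ Ex , y ⟫ + conj α′ * p + conj β′ * q)
                   (trans (form-eichler-u x) (cong (λ n → ⟪ x , u ⟫ + α * n) u-norm)) (form-eichler-e x) ⟩
        ⟪ Ex , y ⟫ + conj α′ * (⟪ x , u ⟫ + α * (s + conj s)) + conj β′ * α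
          ≡⟨ cong (λ p → p + conj α′ * (⟪ x , u ⟫ + α * (s + conj s)) + conj β′ * α) (form-combˡ x α u β e y) ⟩
        ⟪ x , y ⟫ + α * ⟪ u , y ⟫ + β * ⟪ e , y ⟫ + conj α′ * (⟪ x , u ⟫ + α * (s + conj s)) + conj β′ * α
          ≡⟨ cong₂ (λ p q → ⟪ x , y ⟫ + α * ⟪ u , y ⟫ + β * p + conj α′ * (⟪ x , u ⟫ + α * (s + conj s)) + q * α)
                   (form-conj y e) conj-β′ ⟩
        ⟪ x , y ⟫ + α * ⟪ u , y ⟫ + β * conj α′ + conj α′ * (⟪ x , u ⟫ + α * (s + conj s))
          + (- (⟪ u , y ⟫ + conj s * conj α′)) * α
          ≡⟨ solve 7 (λ X α α̅′ p q s s̅ →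
                 X :+ α :* q :+ (:- (p :+ s :* α)) :* α̅′ :+ α̅′ :* (p :+ α :* (s :+ s̅)) :+ (:- (q :+ s̅ :* α̅′)) :* α
              := X) refl ⟪ x , y ⟫ α (conj α′) ⟪ x , u ⟫ ⟪ u , y ⟫ s (conj s) ⟩
        ⟪ x , y ⟫ ∎
        where
          Ex = eichler u s x
          α = ⟪ x , e ⟫
          β = - (⟪ x , u ⟫ + s * α)
          α′ = ⟪ y , e ⟫
          β′ = - (⟪ y , u ⟫ + s * α′)
          conj-β′ : conj β′ ≡ - (⟪ u , y ⟫ + conj s * conj α′)
          conj-β′ = begin
            conj (- (⟪ y , u ⟫ + s * α′))           ≡⟨⟩
            - conj (⟪ y , u ⟫ + s * α′)             ≡⟨ cong -_ (conj-+ ⟪ y , u ⟫ (s * α′)) ⟩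
            - (conj ⟪ y , u ⟫ + conj (s * α′))      ≡⟨ cong₂ (λ p q → - (p + q)) (sym (form-conj y u)) (conj-* s α′) ⟩
            - (⟪ u , y ⟫ + conj s * conj α′)        ∎

      eichler-inverse : ∀ {s′} → s + s′ ≡ ⟪ u , u ⟫ → ∀ x → eichler ((- 1E) · u) s′ (eichler u s x) ≈V x
      eichler-inverse {s′} s+s′≡⟪u,u⟫ x j = begin
        Ex j + ⟪ Ex , e ⟫ * (- 1E * u j) + (- (⟪ Ex , (- 1E) · u ⟫ + s′ * ⟪ Ex , e ⟫)) * e j
          ≡⟨ cong₂ (λ p q → Ex j + p * (- 1E * u j) + (- (q + s′ * p)) * e j) (form-eichler-e x) ⟪Ex,-u⟫ ⟩
        Ex j + α * (- 1E * u j) + (- (- 1E * (⟪ x , u ⟫ + α * (s + s′)) + s′ * α)) * e j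
          ≡⟨ solve 7 (λ a α p s s′ U E →
                 a :+ α :* U :+ (:- (p :+ s :* α)) :* E :+ α :* (:- con 1ℚ :* U)
                   :+ (:- (:- con 1ℚ :* (p :+ α :* (s :+ s′)) :+ s′ :* α)) :* E
              := a) refl (x j) α ⟪ x , u ⟫ s s′ (u j) (e j) ⟩
        x j ∎
        where
          Ex = eichler u s x
          α = ⟪ x , e ⟫
          ⟪Ex,-u⟫ : ⟪ Ex , (- 1E) · u ⟫ ≡ - 1E * (⟪ x , u ⟫ + α * (s + s′))
          ⟪Ex,-u⟫ = begin
            ⟪ Ex , (- 1E) · u ⟫              ≡⟨ form-·ʳ (- 1E) u Ex ⟩
            - 1E * ⟪ Ex , u ⟫                ≡⟨ cong (- 1E *_) (form-eichler-u x) ⟩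
            - 1E * (⟪ x , u ⟫ + α * ⟪ u , u ⟫) ≡⟨ cong (λ n → - 1E * (⟪ x , u ⟫ + α * n)) s+s′≡⟪u,u⟫ ⟨
            - 1E * (⟪ x , u ⟫ + α * (s + s′)) ∎

    eichler-cong : ∀ {u u′} s → u ≈V u′ → ∀ x → eichler u s x ≈V eichler u′ s x
    eichler-cong {u} {u′} s u≈u′ x j =
      cong₂ (λ p q → x j + ⟪ x , e ⟫ * p + (- (q + s * ⟪ x , e ⟫)) * e j) (u≈u′ j) (form-congʳ x u≈u′)

    eichler-fixes : ∀ {b u} s → ⟪ b , e ⟫ ≡ 0E → ⟪ b , u ⟫ ≡ 0E → eichler u s b ≈V b
    eichler-fixes {b} {u} s b⊥e b⊥u j = begin
      b j + ⟪ b , e ⟫ * u j + (- (⟪ b , u ⟫ + s * ⟪ b , e ⟫)) * e j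
        ≡⟨ cong₂ (λ p q → b j + p * u j + (- (q + s * p)) * e j) b⊥e b⊥u ⟩
      b j + 0E * u j + (- (0E + s * 0E)) * e j
        ≡⟨ solve 4 (λ a s U E → a :+ con 0ℚ :* U :+ (:- (con 0ℚ :+ s :* con 0ℚ)) :* E := a) refl (b j) s (u j) (e j) ⟩
      b j ∎

    eichler-unitaryFixing : ∀ {b} u s → ⟪ b , e ⟫ ≡ 0E → ⟪ b , u ⟫ ≡ 0E
                          → ⟪ u , e ⟫ ≡ 0E → ⟪ u , u ⟫ ≡ s + conj s → UnitaryFixing b
    eichler-unitaryFixing {b} u s b⊥e b⊥u u⊥e u-norm = record
      { map = eichler u s
      ; map⁻¹ = eichler -u (conj s)
      ; map-linear = eichler-linear u s
      ; map⁻¹-linear = eichler-linear -u (conj s)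
      ; map⁻¹∘map = eichler-inverse {s = s} u⊥e (sym u-norm)
      ; map∘map⁻¹ = λ x j → trans (eichler-cong s u≈-[-u] (eichler -u (conj s) x) j)
                                  (eichler-inverse {s = conj s} -u⊥e conj-s+s≡⟪-u,-u⟫ x j)
      ; isometry = eichler-isometry {s = s} u⊥e u-norm
      ; fixes = eichler-fixes s b⊥e b⊥u }
      where
        -u = (- 1E) · u
        u≈-[-u] : u ≈V ((- 1E) · -u)
        u≈-[-u] j = solve 1 (λ U → U := :- con 1ℚ :* (:- con 1ℚ :* U)) refl (u j)
        -u⊥e : ⟪ -u , e ⟫ ≡ 0E
        -u⊥e = trans (form-·ˡ (- 1E) u e) (trans (cong (- 1E *_) u⊥e) (zeroʳ (- 1E)))
        conj-s+s≡⟪-u,-u⟫ : conj s + s ≡ ⟪ -u , -u ⟫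
        conj-s+s≡⟪-u,-u⟫ = begin
          conj s + s
            ≡⟨ solve 2 (λ s s̅ → s̅ :+ s := :- con 1ℚ :* (:- con 1ℚ :* (s :+ s̅))) refl s (conj s) ⟩
          - 1E * (- 1E * (s + conj s))
            ≡⟨ cong (λ n → - 1E * (- 1E * n)) u-norm ⟨
          - 1E * (- 1E * ⟪ u , u ⟫)
            ≡⟨ cong (- 1E *_) (form-·ʳ (- 1E) u u) ⟨
          - 1E * ⟪ u , -u ⟫
            ≡⟨ form-·ˡ (- 1E) u -u ⟨
          ⟪ -u , -u ⟫ ∎

    eichler-transitive : ∀ {b} z f → ⟪ b , e ⟫ ≡ 0E → ⟪ z , b ⟫ ≡ ⟪ f , b ⟫
                       → Isotropic d H z → ⟪ z , e ⟫ ≡ 1E → Isotropic d H f → ⟪ f , e ⟫ ≡ 1E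
                       → Σ (UnitaryFixing b) (λ g → map g z ≈V f)
    eichler-transitive {b} z f b⊥e ⟪z,b⟫≡⟪f,b⟫ z-isotropic ⟪z,e⟫≡1 f-isotropic ⟪f,e⟫≡1 =
      eichler-unitaryFixing u s b⊥e b⊥u u⊥e u-norm , Ez≈f
      where
        -- u = f − z + a e and s = −ā give ⟪z,u⟫ + s = a, so z ↦ z + u − a e = f
        a = ⟪ z , f ⟫
        u = f +ᵥ a · e +ᵥ (- 1E) · z
        s = - conj a

        ⟪e,f⟫≡1 : ⟪ e , f ⟫ ≡ 1E
        ⟪e,f⟫≡1 = form-swap f e ⟪f,e⟫≡1

        u⊥e : ⟪ u , e ⟫ ≡ 0E
        u⊥e = begin
          ⟪ u , e ⟫
            ≡⟨ form-combˡ f a e (- 1E) z e ⟩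
          ⟪ f , e ⟫ + a * ⟪ e , e ⟫ + - 1E * ⟪ z , e ⟫
            ≡⟨ cong₂ (λ p q → p + a * q + - 1E * ⟪ z , e ⟫) ⟪f,e⟫≡1 e-isotropic ⟩
          1E + a * 0E + - 1E * ⟪ z , e ⟫
            ≡⟨ cong (λ p → 1E + a * 0E + - 1E * p) ⟪z,e⟫≡1 ⟩
          1E + a * 0E + - 1E * 1E
            ≡⟨ solve 1 (λ a → con 1ℚ :+ a :* con 0ℚ :+ :- con 1ℚ :* con 1ℚ := con 0ℚ) refl a ⟩
          0E ∎

        ⟪u,f⟫≡0 : ⟪ u , f ⟫ ≡ 0E
        ⟪u,f⟫≡0 = begin
          ⟪ u , f ⟫
            ≡⟨ form-combˡ f a e (- 1E) z f ⟩
          ⟪ f , f ⟫ + a * ⟪ e , f ⟫ + - 1E * a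
            ≡⟨ cong₂ (λ p q → p + a * q + - 1E * a) f-isotropic ⟪e,f⟫≡1 ⟩
          0E + a * 1E + - 1E * a
            ≡⟨ solve 1 (λ a → con 0ℚ :+ a :* con 1ℚ :+ :- con 1ℚ :* a := con 0ℚ) refl a ⟩
          0E ∎

        ⟪u,z⟫ : ⟪ u , z ⟫ ≡ conj a + a
        ⟪u,z⟫ = begin
          ⟪ u , z ⟫
            ≡⟨ form-combˡ f a e (- 1E) z z ⟩
          ⟪ f , z ⟫ + a * ⟪ e , z ⟫ + - 1E * ⟪ z , z ⟫
            ≡⟨ cong₂ (λ p q → ⟪ f , z ⟫ + a * p + - 1E * q) (form-swap z e ⟪z,e⟫≡1) z-isotropic ⟩
          ⟪ f , z ⟫ + a * 1E + - 1E * 0E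
            ≡⟨ cong (λ p → p + a * 1E + - 1E * 0E) (form-conj z f) ⟩
          conj a + a * 1E + - 1E * 0E
            ≡⟨ solve 2 (λ a a̅ → a̅ :+ a :* con 1ℚ :+ :- con 1ℚ :* con 0ℚ := a̅ :+ a) refl a (conj a) ⟩
          conj a + a ∎

        u-norm : ⟪ u , u ⟫ ≡ s + conj s
        u-norm = begin
          ⟪ u , u ⟫
            ≡⟨ form-combʳ f a e (- 1E) z u ⟩
          ⟪ u , f ⟫ + conj a * ⟪ u , e ⟫ + conj (- 1E) * ⟪ u , z ⟫
            ≡⟨ cong₂ (λ p q → p + conj a * q + conj (- 1E) * ⟪ u , z ⟫) ⟪u,f⟫≡0 u⊥e ⟩
          0E + conj a * 0E + conj (- 1E) * ⟪ u , z ⟫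
            ≡⟨ cong (λ p → 0E + conj a * 0E + conj (- 1E) * p) ⟪u,z⟫ ⟩
          0E + conj a * 0E + - 1E * (conj a + a)
            ≡⟨ solve 2 (λ a a̅ → con 0ℚ :+ a̅ :* con 0ℚ :+ :- con 1ℚ :* (a̅ :+ a) := :- a̅ :+ :- a) refl a (conj a) ⟩
          - conj a + - a
            ≡⟨ cong (λ p → - conj a + - p) (conj-involutive a) ⟨
          s + conj s ∎

        b⊥u : ⟪ b , u ⟫ ≡ 0E
        b⊥u = begin
          ⟪ b , u ⟫
            ≡⟨ form-combʳ f a e (- 1E) z b ⟩
          ⟪ b , f ⟫ + conj a * ⟪ b , e ⟫ + conj (- 1E) * ⟪ b , z ⟫
            ≡⟨ cong₂ (λ p q → ⟪ b , f ⟫ + conj a * p + conj (- 1E) * q) b⊥e ⟪b,z⟫≡⟪b,f⟫ ⟩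
          ⟪ b , f ⟫ + conj a * 0E + - 1E * ⟪ b , f ⟫
            ≡⟨ solve 2 (λ p a̅ → p :+ a̅ :* con 0ℚ :+ :- con 1ℚ :* p := con 0ℚ) refl ⟪ b , f ⟫ (conj a) ⟩
          0E ∎
          where
            ⟪b,z⟫≡⟪b,f⟫ : ⟪ b , z ⟫ ≡ ⟪ b , f ⟫
            ⟪b,z⟫≡⟪b,f⟫ = trans (form-swap z b ⟪z,b⟫≡⟪f,b⟫) (sym (form-conj f b))

        Ez≈f : eichler u s z ≈V f
        Ez≈f j = begin
          z j + ⟪ z , e ⟫ * u j + (- (⟪ z , u ⟫ + s * ⟪ z , e ⟫)) * e j
            ≡⟨ cong₂ (λ p q → z j + p * u j + (- (q + s * p)) * e j) ⟪z,e⟫≡1 ⟪z,u⟫ ⟩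
          z j + 1E * u j + (- (a + conj a + s * 1E)) * e j
            ≡⟨ solve 5 (λ Z F E a a̅ →
                   Z :+ con 1ℚ :* (F :+ a :* E :+ :- con 1ℚ :* Z) :+ (:- (a :+ a̅ :+ (:- a̅) :* con 1ℚ)) :* E := F)
                 refl (z j) (f j) (e j) a (conj a) ⟩
          f j ∎
          where
            ⟪z,u⟫ : ⟪ z , u ⟫ ≡ a + conj a
            ⟪z,u⟫ = begin
              ⟪ z , u ⟫
                ≡⟨ form-combʳ f a e (- 1E) z z ⟩
              a + conj a * ⟪ z , e ⟫ + conj (- 1E) * ⟪ z , z ⟫
                ≡⟨ cong₂ (λ p q → a + conj a * p + conj (- 1E) * q) ⟪z,e⟫≡1 z-isotropic ⟩
              a + conj a * 1E + - 1E * 0E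
                ≡⟨ solve 2 (λ a a̅ → a :+ a̅ :* con 1ℚ :+ :- con 1ℚ :* con 0ℚ := a :+ a̅) refl a (conj a) ⟩
              a + conj a ∎

    eichler-transitive-scaled : ∀ {b} f x → ⟪ b , e ⟫ ≡ 0E → Isotropic d H f → ⟪ f , e ⟫ ≡ 1E
                              → Isotropic d H x → ⟪ x , e ⟫ ≢ 0E → ⟪ x , b ⟫ ≡ ⟪ x , e ⟫ * ⟪ f , b ⟫
                              → Σ (UnitaryFixing b) (λ g → map g x ≈V (⟪ x , e ⟫ · f))
    eichler-transitive-scaled {b} f x b⊥e f-isotropic ⟪f,e⟫≡1 x-isotropic β≢0 ⟪x,b⟫≡β⟪f,b⟫ =
      g , gx≈βf
      where
        β = ⟪ x , e ⟫
        β⁻¹ = proj₁ (inverse β β≢0)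
        z = β⁻¹ · x

        β⁻¹β≡1 : β⁻¹ * β ≡ 1E
        β⁻¹β≡1 = trans (*-comm β⁻¹ β) (proj₂ (inverse β β≢0))

        β⁻¹[βt]≡t : ∀ t → β⁻¹ * (β * t) ≡ t
        β⁻¹[βt]≡t t = trans (sym (*-assoc β⁻¹ β t)) (trans (cong (_* t) β⁻¹β≡1) (*-identityˡ t))

        z-isotropic : Isotropic d H z
        z-isotropic = begin
          ⟪ z , z ⟫                     ≡⟨ form-·ˡ β⁻¹ x z ⟩
          β⁻¹ * ⟪ x , z ⟫               ≡⟨ cong (β⁻¹ *_) (form-·ʳ β⁻¹ x x) ⟩
          β⁻¹ * (conj β⁻¹ * ⟪ x , x ⟫)  ≡⟨ cong (λ p → β⁻¹ * (conj β⁻¹ * p)) x-isotropic ⟩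
          β⁻¹ * (conj β⁻¹ * 0E)         ≡⟨ cong (β⁻¹ *_) (zeroʳ (conj β⁻¹)) ⟩
          β⁻¹ * 0E                      ≡⟨ zeroʳ β⁻¹ ⟩
          0E                            ∎

        ⟪z,e⟫≡1 : ⟪ z , e ⟫ ≡ 1E
        ⟪z,e⟫≡1 = trans (form-·ˡ β⁻¹ x e) β⁻¹β≡1

        ⟪z,b⟫≡⟪f,b⟫ : ⟪ z , b ⟫ ≡ ⟪ f , b ⟫
        ⟪z,b⟫≡⟪f,b⟫ = trans (form-·ˡ β⁻¹ x b) (trans (cong (β⁻¹ *_) ⟪x,b⟫≡β⟪f,b⟫) (β⁻¹[βt]≡t ⟪ f , b ⟫))

        g,gz≈f = eichler-transitive z f b⊥e ⟪z,b⟫≡⟪f,b⟫ z-isotropic ⟪z,e⟫≡1 f-isotropic ⟪f,e⟫≡1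
        g = proj₁ g,gz≈f

        gx≈βf : map g x ≈V (β · f)
        gx≈βf j = begin
          map g x j          ≡⟨ IsLinear.≈-cong g-linear x≈βz j ⟩
          map g (β · z) j    ≡⟨ IsLinear.·-homo g-linear β z j ⟩
          β * map g z j      ≡⟨ cong (β *_) (proj₂ g,gz≈f j) ⟩
          β * f j            ∎
          where
            g-linear = UnitaryFixing.map-linear g
            x≈βz : x ≈V (β · z)
            x≈βz i = sym (trans (sym (*-assoc β β⁻¹ (x i)))
                                (trans (cong (_* x i) (proj₂ (inverse β β≢0))) (*-identityˡ (x i))))

module ThreeOrbits
  (d : ℕ) (d≢0 : d ≢ 0) {N : ℕ} (H : Mat N) (herm : IsHermitian H) (nondeg : Nondegenerate d H)
  (b₁ b₂ c₁ c₂ : Vec N)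
  (b₁-isotropic : Isotropic d H b₁) (b₂-isotropic : Isotropic d H b₂) (⟪b₁,b₂⟫≡1 : form d H b₁ b₂ ≡ 1E)
  (c₁⊥b₁ : form d H c₁ b₁ ≡ 0E) (c₁⊥b₂ : form d H c₁ b₂ ≡ 0E) (c₂⊥b₁ : form d H c₂ b₁ ≡ 0E)
  (c₁-isotropic : Isotropic d H c₁) (c₂-isotropic : Isotropic d H c₂) (⟪c₁,c₂⟫≡1 : form d H c₁ c₂ ≡ 1E)
  where

  open HermitianSpace d d≢0 H herm
  open UnitaryFixing using (map; map-linear; isometry; fixes)
  open ≡-Reasoning

  private
    ⟪b₂,b₁⟫≡1 : ⟪ b₂ , b₁ ⟫ ≡ 1E
    ⟪b₂,b₁⟫≡1 = form-swap b₁ b₂ ⟪b₁,b₂⟫≡1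

    ⟪c₂,c₁⟫≡1 : ⟪ c₂ , c₁ ⟫ ≡ 1E
    ⟪c₂,c₁⟫≡1 = form-swap c₁ c₂ ⟪c₁,c₂⟫≡1

    b₁⊥c₁ : ⟪ b₁ , c₁ ⟫ ≡ 0E
    b₁⊥c₁ = form-swap c₁ b₁ c₁⊥b₁

    b₁⊥c₂ : ⟪ b₁ , c₂ ⟫ ≡ 0E
    b₁⊥c₂ = form-swap c₂ b₁ c₂⊥b₁

    b₂⊥c₁ : ⟪ b₂ , c₁ ⟫ ≡ 0E
    b₂⊥c₁ = form-swap c₁ b₂ c₁⊥b₂

  InThreeOrbits : V → Set
  InThreeOrbits v = SameOrbit d H b₁ v b₁ ⊎ SameOrbit d H b₁ v c₁ ⊎ SameOrbit d H b₁ v b₂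

  -- vanishes exactly when v ∈ E b₁
  off-b₁ : V → V
  off-b₁ v = v +ᵥ (- ⟪ v , b₂ ⟫) · b₁

  on-Eb₁⇒orbit-b₁ : ∀ v → ¬ IsZeroV v → IsZeroV (off-b₁ v) → SameOrbit d H b₁ v b₁
  on-Eb₁⇒orbit-b₁ v v≢0 off≡0 = sameOrbit idᵘ v b₁ a≢0 v≈ab₁
    where
      a = ⟪ v , b₂ ⟫
      v≈ab₁ : v ≈V (a · b₁)
      v≈ab₁ j = begin
        v j                            ≡⟨ solve 3 (λ v a b → v := v :+ (:- a) :* b :+ a :* b) refl (v j) a (b₁ j) ⟩
        v j + (- a) * b₁ j + a * b₁ j  ≡⟨ cong (_+ a * b₁ j) (off≡0 j) ⟩
        0E + a * b₁ j                  ≡⟨ +-identityˡ (a * b₁ j) ⟩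
        a * b₁ j                       ∎
      a≢0 : a ≢ 0E
      a≢0 a≡0 = v≢0 (λ j → trans (v≈ab₁ j) (trans (cong (_* b₁ j) a≡0) (zeroˡ (b₁ j))))

  not-orthogonal-to-b₁⇒orbit-b₂ : ∀ v → Isotropic d H v → ⟪ v , b₁ ⟫ ≢ 0E → SameOrbit d H b₁ v b₂
  not-orthogonal-to-b₁⇒orbit-b₂ v v-isotropic α≢0 = sameOrbit (proj₁ g,gv≈αb₂) v b₂ α≢0 (proj₂ g,gv≈αb₂)
    where
      open Eichler b₁ b₁-isotropic
      g,gv≈αb₂ = eichler-transitive-scaled b₂ v b₁-isotropic b₂-isotropic ⟪b₂,b₁⟫≡1 v-isotropic α≢0
                   (sym (trans (cong (⟪ v , b₁ ⟫ *_) ⟪b₂,b₁⟫≡1) (*-identityʳ ⟪ v , b₁ ⟫)))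

  PairsWithC₂ : V → Set
  PairsWithC₂ v = Σ (UnitaryFixing b₁) (λ g → ⟪ map g v , c₂ ⟫ ≢ 0E)

  private
    ⟪eichler-c₁,c₂⟫ : ∀ u s v → ⟪ v , c₂ ⟫ ≡ 0E
                     → ⟪ Eichler.eichler c₁ c₁-isotropic u s v , c₂ ⟫
                       ≡ ⟪ v , c₁ ⟫ * ⟪ u , c₂ ⟫ + - (⟪ v , u ⟫ + s * ⟪ v , c₁ ⟫)
    ⟪eichler-c₁,c₂⟫ u s v v⊥c₂ = begin
      ⟪ v +ᵥ γ · u +ᵥ β · c₁ , c₂ ⟫
        ≡⟨ form-combˡ v γ u β c₁ c₂ ⟩
      ⟪ v , c₂ ⟫ + γ * ⟪ u , c₂ ⟫ + β * ⟪ c₁ , c₂ ⟫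
        ≡⟨ cong₂ (λ p q → p + γ * ⟪ u , c₂ ⟫ + β * q) v⊥c₂ ⟪c₁,c₂⟫≡1 ⟩
      0E + γ * ⟪ u , c₂ ⟫ + β * 1E
        ≡⟨ solve 2 (λ p β → con 0ℚ :+ p :+ β :* con 1ℚ := p :+ β) refl (γ * ⟪ u , c₂ ⟫) β ⟩
      γ * ⟪ u , c₂ ⟫ + β ∎
      where
        γ = ⟪ v , c₁ ⟫
        β = - (⟪ v , u ⟫ + s * γ)

  -- with u = 0 the Eichler transformation needs s + s̄ = 0; s = √-d turns ⟪v,c₂⟫ = 0 into −√-d ⟪v,c₁⟫
  pairsWithC₂-if-⟪v,c₁⟫≢0 : ∀ v → ⟪ v , c₂ ⟫ ≡ 0E → ⟪ v , c₁ ⟫ ≢ 0E → PairsWithC₂ v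
  pairsWithC₂-if-⟪v,c₁⟫≢0 v v⊥c₂ γ≢0 =
    eichler-unitaryFixing 0ᵥ √-d b₁⊥c₁ (form-0ʳ b₁) (form-0ˡ c₁) (trans (form-0ˡ 0ᵥ) (sym √-d+conj√-d≡0)) ,
    λ ⟪gv,c₂⟫≡0 → γ≢0 (x*y≡0⇒y≡0 -√-d≢0 (begin
      (- √-d) * γ
        ≡⟨ solve 2 (λ r γ → (:- r) :* γ := γ :* con 0ℚ :+ :- (con 0ℚ :+ r :* γ)) refl √-d γ ⟩
      γ * 0E + - (0E + √-d * γ)
        ≡⟨ cong₂ (λ p q → γ * p + - (q + √-d * γ)) (form-0ˡ c₂) (form-0ʳ v) ⟨
      γ * ⟪ 0ᵥ , c₂ ⟫ + - (⟪ v , 0ᵥ ⟫ + √-d * γ)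
        ≡⟨ ⟪eichler-c₁,c₂⟫ 0ᵥ √-d v v⊥c₂ ⟨
      ⟪ eichler 0ᵥ √-d v , c₂ ⟫
        ≡⟨ ⟪gv,c₂⟫≡0 ⟩
      0E ∎))
    where
      open Eichler c₁ c₁-isotropic
      γ = ⟪ v , c₁ ⟫
      -√-d≢0 : - √-d ≢ 0E
      -√-d≢0 ()

  pairsWithC₂-if-⟪v,c₁⟫≡0 : ∀ v → ⟪ v , c₂ ⟫ ≡ 0E → ⟪ v , c₁ ⟫ ≡ 0E → ¬ IsZeroV (off-b₁ v) → PairsWithC₂ v
  pairsWithC₂-if-⟪v,c₁⟫≡0 v v⊥c₂ v⊥c₁ w≢0 = eichler-unitaryFixing u s b₁⊥c₁ b₁⊥u u⊥c₁ u-norm , Ev-pairs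
    where
      open Eichler c₁ c₁-isotropic
      y = proj₁ (nondegenerate-witness nondeg (off-b₁ v) w≢0)
      -- removing the c₂- and b₂-components of y makes u ⊥ b₁, c₁ while ⟪v,u⟫ = ⟪off-b₁ v,y⟫
      u = y +ᵥ (- ⟪ y , c₁ ⟫) · c₂ +ᵥ (- ⟪ y , b₁ ⟫) · b₂
      s = ι ½ * ⟪ u , u ⟫

      b₁⊥u : ⟪ b₁ , u ⟫ ≡ 0E
      b₁⊥u = begin
        ⟪ b₁ , u ⟫
          ≡⟨ form-combʳ y (- ⟪ y , c₁ ⟫) c₂ (- ⟪ y , b₁ ⟫) b₂ b₁ ⟩
        ⟪ b₁ , y ⟫ + conj (- ⟪ y , c₁ ⟫) * ⟪ b₁ , c₂ ⟫ + (- conj ⟪ y , b₁ ⟫) * ⟪ b₁ , b₂ ⟫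
          ≡⟨ cong₂ (λ p q → p + conj (- ⟪ y , c₁ ⟫) * q + (- conj ⟪ y , b₁ ⟫) * ⟪ b₁ , b₂ ⟫) (form-conj y b₁) b₁⊥c₂ ⟩
        conj ⟪ y , b₁ ⟫ + conj (- ⟪ y , c₁ ⟫) * 0E + (- conj ⟪ y , b₁ ⟫) * ⟪ b₁ , b₂ ⟫
          ≡⟨ cong (λ p → conj ⟪ y , b₁ ⟫ + conj (- ⟪ y , c₁ ⟫) * 0E + (- conj ⟪ y , b₁ ⟫) * p) ⟪b₁,b₂⟫≡1 ⟩
        conj ⟪ y , b₁ ⟫ + conj (- ⟪ y , c₁ ⟫) * 0E + (- conj ⟪ y , b₁ ⟫) * 1E
          ≡⟨ solve 2 (λ p q → p :+ q :* con 0ℚ :+ (:- p) :* con 1ℚ := con 0ℚ)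
                   refl (conj ⟪ y , b₁ ⟫) (conj (- ⟪ y , c₁ ⟫)) ⟩
        0E ∎

      u⊥c₁ : ⟪ u , c₁ ⟫ ≡ 0E
      u⊥c₁ = begin
        ⟪ u , c₁ ⟫
          ≡⟨ form-combˡ y (- ⟪ y , c₁ ⟫) c₂ (- ⟪ y , b₁ ⟫) b₂ c₁ ⟩
        ⟪ y , c₁ ⟫ + (- ⟪ y , c₁ ⟫) * ⟪ c₂ , c₁ ⟫ + (- ⟪ y , b₁ ⟫) * ⟪ b₂ , c₁ ⟫
          ≡⟨ cong₂ (λ p q → ⟪ y , c₁ ⟫ + (- ⟪ y , c₁ ⟫) * p + (- ⟪ y , b₁ ⟫) * q) ⟪c₂,c₁⟫≡1 b₂⊥c₁ ⟩
        ⟪ y , c₁ ⟫ + (- ⟪ y , c₁ ⟫) * 1E + (- ⟪ y , b₁ ⟫) * 0E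
          ≡⟨ solve 2 (λ p q → p :+ (:- p) :* con 1ℚ :+ (:- q) :* con 0ℚ := con 0ℚ) refl ⟪ y , c₁ ⟫ ⟪ y , b₁ ⟫ ⟩
        0E ∎

      u-norm : ⟪ u , u ⟫ ≡ s + conj s
      u-norm = sym (½*x+conj[½*x]≡x ⟪ u , u ⟫ (sym (form-conj u u)))

      ⟪v,u⟫≡⟪w,y⟫ : ⟪ v , u ⟫ ≡ ⟪ off-b₁ v , y ⟫
      ⟪v,u⟫≡⟪w,y⟫ = begin
        ⟪ v , u ⟫
          ≡⟨ form-combʳ y (- ⟪ y , c₁ ⟫) c₂ (- ⟪ y , b₁ ⟫) b₂ v ⟩
        ⟪ v , y ⟫ + conj (- ⟪ y , c₁ ⟫) * ⟪ v , c₂ ⟫ + (- conj ⟪ y , b₁ ⟫) * ⟪ v , b₂ ⟫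
          ≡⟨ cong₂ (λ p q → ⟪ v , y ⟫ + conj (- ⟪ y , c₁ ⟫) * p + (- q) * ⟪ v , b₂ ⟫) (sym v⊥c₂) (form-conj y b₁) ⟨
        ⟪ v , y ⟫ + conj (- ⟪ y , c₁ ⟫) * 0E + (- ⟪ b₁ , y ⟫) * ⟪ v , b₂ ⟫
          ≡⟨ solve 4 (λ p q r t → p :+ q :* con 0ℚ :+ (:- r) :* t := p :+ (:- t) :* r)
               refl ⟪ v , y ⟫ (conj (- ⟪ y , c₁ ⟫)) ⟪ b₁ , y ⟫ ⟪ v , b₂ ⟫ ⟩
        ⟪ v , y ⟫ + (- ⟪ v , b₂ ⟫) * ⟪ b₁ , y ⟫
          ≡⟨ trans (form-+ˡ v ((- ⟪ v , b₂ ⟫) · b₁) y) (cong (⟪ v , y ⟫ +_) (form-·ˡ (- ⟪ v , b₂ ⟫) b₁ y)) ⟨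
        ⟪ off-b₁ v , y ⟫ ∎

      Ev-pairs : ⟪ eichler u s v , c₂ ⟫ ≢ 0E
      Ev-pairs ⟪Ev,c₂⟫≡0 = proj₂ (nondegenerate-witness nondeg (off-b₁ v) w≢0) (begin
        ⟪ off-b₁ v , y ⟫
          ≡⟨ ⟪v,u⟫≡⟪w,y⟫ ⟨
        ⟪ v , u ⟫
          ≡⟨ solve 3 (λ p q s → p := :- (con 0ℚ :* q :+ :- (p :+ s :* con 0ℚ))) refl ⟪ v , u ⟫ ⟪ u , c₂ ⟫ s ⟩
        - (0E * ⟪ u , c₂ ⟫ + - (⟪ v , u ⟫ + s * 0E))
          ≡⟨ cong (λ γ → - (γ * ⟪ u , c₂ ⟫ + - (⟪ v , u ⟫ + s * γ))) v⊥c₁ ⟨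
        - (⟪ v , c₁ ⟫ * ⟪ u , c₂ ⟫ + - (⟪ v , u ⟫ + s * ⟪ v , c₁ ⟫))
          ≡⟨ cong -_ (⟪eichler-c₁,c₂⟫ u s v v⊥c₂) ⟨
        - ⟪ eichler u s v , c₂ ⟫
          ≡⟨ cong -_ ⟪Ev,c₂⟫≡0 ⟩
        0E ∎)

  pairsWithC₂ : ∀ v → ¬ IsZeroV (off-b₁ v) → PairsWithC₂ v
  pairsWithC₂ v w≢0 = by-⟪v,c₂⟫ (⟪ v , c₂ ⟫ ≟ 0E)
    where
      by-⟪v,c₁⟫ : ⟪ v , c₂ ⟫ ≡ 0E → Dec (⟪ v , c₁ ⟫ ≡ 0E) → PairsWithC₂ v
      by-⟪v,c₁⟫ v⊥c₂ (yes v⊥c₁) = pairsWithC₂-if-⟪v,c₁⟫≡0 v v⊥c₂ v⊥c₁ w≢0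
      by-⟪v,c₁⟫ v⊥c₂ (no γ≢0)   = pairsWithC₂-if-⟪v,c₁⟫≢0 v v⊥c₂ γ≢0

      by-⟪v,c₂⟫ : Dec (⟪ v , c₂ ⟫ ≡ 0E) → PairsWithC₂ v
      by-⟪v,c₂⟫ (no ⟪v,c₂⟫≢0) = idᵘ , ⟪v,c₂⟫≢0
      by-⟪v,c₂⟫ (yes v⊥c₂)    = by-⟪v,c₁⟫ v⊥c₂ (⟪ v , c₁ ⟫ ≟ 0E)

  orthogonal-to-b₁⇒orbit-c₁ : ∀ v → Isotropic d H v → ⟪ v , b₁ ⟫ ≡ 0E → ¬ IsZeroV (off-b₁ v) → SameOrbit d H b₁ v c₁
  orthogonal-to-b₁⇒orbit-c₁ v v-isotropic v⊥b₁ w≢0 = sameOrbit (proj₁ g₂,g₂x≈βc₁ ∘ᵘ g₁) v c₁ β≢0 (proj₂ g₂,g₂x≈βc₁)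
    where
      g₁ = proj₁ (pairsWithC₂ v w≢0)
      β≢0 = proj₂ (pairsWithC₂ v w≢0)
      x = map g₁ v
      β = ⟪ x , c₂ ⟫

      ⟪x,b₁⟫≡β⟪c₁,b₁⟫ : ⟪ x , b₁ ⟫ ≡ β * ⟪ c₁ , b₁ ⟫
      ⟪x,b₁⟫≡β⟪c₁,b₁⟫ = begin
        ⟪ x , b₁ ⟫          ≡⟨ form-congʳ x (fixes g₁) ⟨
        ⟪ x , map g₁ b₁ ⟫   ≡⟨ isometry g₁ v b₁ ⟩
        ⟪ v , b₁ ⟫          ≡⟨ v⊥b₁ ⟩
        0E                  ≡⟨ zeroʳ β ⟨
        β * 0E              ≡⟨ cong (β *_) c₁⊥b₁ ⟨
        β * ⟪ c₁ , b₁ ⟫     ∎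

      g₂,g₂x≈βc₁ = Eichler.eichler-transitive-scaled c₂ c₂-isotropic c₁ x b₁⊥c₂ c₁-isotropic ⟪c₁,c₂⟫≡1
                     (trans (isometry g₁ v v) v-isotropic) β≢0 ⟪x,b₁⟫≡β⟪c₁,b₁⟫

  isotropic⇒inThreeOrbits : ∀ v → ¬ IsZeroV v → Isotropic d H v → InThreeOrbits v
  isotropic⇒inThreeOrbits v v≢0 v-isotropic = by-⟪v,b₁⟫ (⟪ v , b₁ ⟫ ≟ 0E)
    where
      by-off-b₁ : ⟪ v , b₁ ⟫ ≡ 0E → Dec (IsZeroV (off-b₁ v)) → InThreeOrbits v
      by-off-b₁ _    (yes w≡0) = inj₁ (on-Eb₁⇒orbit-b₁ v v≢0 w≡0)
      by-off-b₁ v⊥b₁ (no w≢0)  = inj₂ (inj₁ (orthogonal-to-b₁⇒orbit-c₁ v v-isotropic v⊥b₁ w≢0))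

      by-⟪v,b₁⟫ : Dec (⟪ v , b₁ ⟫ ≡ 0E) → InThreeOrbits v
      by-⟪v,b₁⟫ (no ⟪v,b₁⟫≢0) = inj₂ (inj₂ (not-orthogonal-to-b₁⇒orbit-b₂ v v-isotropic ⟪v,b₁⟫≢0))
      by-⟪v,b₁⟫ (yes v⊥b₁)    = by-off-b₁ v⊥b₁ (all? (λ j → off-b₁ v j ≟ 0E))

  b₁≁c₁ : ¬ SameOrbit d H b₁ b₁ c₁
  b₁≁c₁ (g , (_ , c′ , b₁g≈c′b₁) , c , c≢0 , b₁g≈cc₁) = c≢0 (begin
    c                   ≡⟨ *-identityʳ c ⟨
    c * 1E              ≡⟨ cong (c *_) ⟪c₁,c₂⟫≡1 ⟨
    c * ⟪ c₁ , c₂ ⟫      ≡⟨ ·≈·⇒form≡ c c₁ c′ b₁ (λ j → trans (sym (b₁g≈cc₁ j)) (b₁g≈c′b₁ j)) c₂ ⟩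
    c′ * ⟪ b₁ , c₂ ⟫     ≡⟨ cong (c′ *_) b₁⊥c₂ ⟩
    c′ * 0E             ≡⟨ zeroʳ c′ ⟩
    0E                  ∎)

  b₁≁b₂ : ¬ SameOrbit d H b₁ b₁ b₂
  b₁≁b₂ (g , (_ , c′ , b₁g≈c′b₁) , c , c≢0 , b₁g≈cb₂) = c≢0 (begin
    c                   ≡⟨ *-identityʳ c ⟨
    c * 1E              ≡⟨ cong (c *_) ⟪b₂,b₁⟫≡1 ⟨
    c * ⟪ b₂ , b₁ ⟫      ≡⟨ ·≈·⇒form≡ c b₂ c′ b₁ (λ j → trans (sym (b₁g≈cb₂ j)) (b₁g≈c′b₁ j)) b₁ ⟩
    c′ * ⟪ b₁ , b₁ ⟫     ≡⟨ cong (c′ *_) b₁-isotropic ⟩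
    c′ * 0E             ≡⟨ zeroʳ c′ ⟩
    0E                  ∎)

  c₁≁b₂ : ¬ SameOrbit d H b₁ c₁ b₂
  c₁≁b₂ (g , ((preserves , _) , c′ , b₁g≈c′b₁) , c , c≢0 , c₁g≈cb₂) = conj-≢0 c′≢0 (x*y≡0⇒y≡0 c≢0 (begin
    c * conj c′
      ≡⟨ cong (c *_) (trans (sym (*-identityʳ (conj c′))) (cong (conj c′ *_) (sym ⟪b₂,b₁⟫≡1))) ⟩
    c * (conj c′ * ⟪ b₂ , b₁ ⟫)
      ≡⟨ cong (c *_) (form-·ʳ c′ b₁ b₂) ⟨
    c * ⟪ b₂ , c′ · b₁ ⟫
      ≡⟨ form-·ˡ c b₂ (c′ · b₁) ⟨
    ⟪ c · b₂ , c′ · b₁ ⟫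
      ≡⟨ form-cong c₁g≈cb₂ b₁g≈c′b₁ ⟨
    ⟪ act d c₁ g , act d b₁ g ⟫
      ≡⟨ preserves c₁ b₁ ⟩
    ⟪ c₁ , b₁ ⟫
      ≡⟨ c₁⊥b₁ ⟩
    0E ∎))
    where
      c′≢0 : c′ ≢ 0E
      c′≢0 c′≡0 = 1≢0 (begin
        1E                               ≡⟨ ⟪b₁,b₂⟫≡1 ⟨
        ⟪ b₁ , b₂ ⟫                       ≡⟨ preserves b₁ b₂ ⟨
        ⟪ act d b₁ g , act d b₂ g ⟫       ≡⟨ form-congˡ (act d b₂ g) b₁g≈c′b₁ ⟩
        ⟪ c′ · b₁ , act d b₂ g ⟫          ≡⟨ form-·ˡ c′ b₁ (act d b₂ g) ⟩
        c′ * ⟪ b₁ , act d b₂ g ⟫          ≡⟨ cong (_* ⟪ b₁ , act d b₂ g ⟫) c′≡0 ⟩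
        0E * ⟪ b₁ , act d b₂ g ⟫          ≡⟨ zeroˡ ⟪ b₁ , act d b₂ g ⟫ ⟩
        0E                               ∎)

SquarefreePos⇒≢0 : ∀ {d} → SquarefreePos d → d ≢ 0
SquarefreePos⇒≢0 squarefree refl = 0≢1+n (squarefree 0 (0 ∣0))

open import Data.Nat using (_+_)

lemma3p6 : (d : ℕ) → SquarefreePos d → (n : ℕ) → (H : Mat (2 + n))
    → IsHermitian H → Nondegenerate d H → HasSignature d 2 n H
    → (b₁ b₂ c₁ c₂ : Vec (2 + n))
    → Isotropic d H b₁ → Isotropic d H b₂ → form d H b₁ b₂ ≡ 1E
    → form d H c₁ b₁ ≡ 0E → form d H c₁ b₂ ≡ 0E
    → form d H c₂ b₁ ≡ 0E → form d H c₂ b₂ ≡ 0E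
    → Isotropic d H c₁ → Isotropic d H c₂ → form d H c₁ c₂ ≡ 1E
    → ((v : Vec (2 + n)) → ¬ IsZeroV v → Isotropic d H v
         → SameOrbit d H b₁ v b₁ ⊎ SameOrbit d H b₁ v c₁ ⊎ SameOrbit d H b₁ v b₂)
      × ¬ SameOrbit d H b₁ b₁ c₁
      × ¬ SameOrbit d H b₁ b₁ b₂
      × ¬ SameOrbit d H b₁ c₁ b₂
lemma3p6 d squarefree n H herm nondeg _ b₁ b₂ c₁ c₂
         b₁-isotropic b₂-isotropic ⟪b₁,b₂⟫≡1 c₁⊥b₁ c₁⊥b₂ c₂⊥b₁ _ c₁-isotropic c₂-isotropic ⟪c₁,c₂⟫≡1 =
  isotropic⇒inThreeOrbits , b₁≁c₁ , b₁≁b₂ , c₁≁b₂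
  where
    open ThreeOrbits d (SquarefreePos⇒≢0 squarefree) H herm nondeg b₁ b₂ c₁ c₂
                     b₁-isotropic b₂-isotropic ⟪b₁,b₂⟫≡1 c₁⊥b₁ c₁⊥b₂ c₂⊥b₁ c₁-isotropic c₂-isotropic ⟪c₁,c₂⟫≡1
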